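{- Let $w$ be an irreducible packed word and let $u,v$ be packed words with $v\ne\varepsilon$ and $w=u\triangleleft_R v$. Then $(u,v)$ is the red-factorization of $w$ if and only if $v$ is red-irreducible.
   Context: Words over positive integers; $|w|$ length, $\max(w)$ largest letter ($\max(\varepsilon)=0$), $w^{[k]}$ adds $k$ to every letter. Packed: every integer $1..\max(w)$ occurs. $u\odot v=u^{[\max(v)]}\cdot v$. A global descent of $w$ of length $n$ is $c$, $1\le c\le n-1$, with every letter of $w_1..w_c$ strictly greater than every letter of $w_{c+1}..w_n$; $w$ is irreducible if nonempty with no global descent. For packed $w$ of length $n$, $p\ge1$, $I=\{i_1<\dots<i_p\}\subseteq\{1..n+p\}$, $\phi_I(w)$ is the word of length $n+p$ with letter $\max(w)+1$ at the positions of $I$ and the letters of $w$ in order elsewhere; every nonempty packed $v$ is uniquely $\phi_I(v')$. For packed $u$ and nonempty packed $v=\phi_I(v')$, $u\triangleleft_R v=\phi_{I+|u|}(u\odot v')$, $I+|u|=\{i+|u|:i\in I\}$. The red-factorization of irreducible $w$ is the unique pair $(u,v)$ of packed words with $v\ne\varepsilon$, $w=u\triangleleft_R v$ and $|u|$ maximal. A packed word $v$ is red-irreducible if it is irreducible and $v=x\triangleleft_R y$ with $y\ne\varepsilon$ implies $x=\varepsilon$. -}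

module Defs where

open import Data.Nat using (ℕ; zero; suc; _+_; _≤_; _<_; _⊔_)
open import Data.Nat.Properties using (_≟_)
open import Data.List using (List; []; _∷_; _++_; map; foldr; length; take; drop)
open import Data.List.Membership.Propositional using (_∈_)
open import Data.List.Membership.DecPropositional _≟_ using (_∈?_)
open import Data.List.Relation.Unary.All using (All)
open import Data.List.Relation.Unary.Linked using (Linked)
open import Data.Product using (Σ; _×_; ∃)
open import Relation.Nullary using (¬_; yes; no)
open import Relation.Binary.PropositionalEquality using (_≡_; _≢_)

-- words over positive integers are lists of naturals, all ≥ 1
Word : Set
Word = List ℕ

maxW : Word → ℕ
maxW = foldr _⊔_ 0

shiftW : ℕ → Word → Word
shiftW k = map (k +_)

Packed : Word → Set
Packed w = All (1 ≤_) w × (∀ k → 1 ≤ k → k ≤ maxW w → k ∈ w)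

_⊙_ : Word → Word → Word
u ⊙ v = shiftW (maxW v) u ++ v

GlobalDescent : Word → ℕ → Set
GlobalDescent w c =
  1 ≤ c × suc c ≤ length w ×
  (∀ a → a ∈ take c w → ∀ b → b ∈ drop c w → b < a)

Irreducible : Word → Set
Irreducible w = w ≢ [] × (∀ c → ¬ GlobalDescent w c)

-- position sets I = {i₁ < … < i_p} ⊆ {1..n+p}, p ≥ 1, given as strictly increasing lists
ValidPos : Word → List ℕ → Set
ValidPos w I =
  I ≢ [] × Linked _<_ I × All (λ i → 1 ≤ i × i ≤ length w + length I) I

phiGo : ℕ → ℕ → ℕ → List ℕ → Word → Word
phiGo m pos zero    I w = []
phiGo m pos (suc k) I w with pos ∈? I
... | yes _ = m ∷ phiGo m (suc pos) k I w
phiGo m pos (suc k) I []       | no _ = []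
phiGo m pos (suc k) I (x ∷ w)  | no _ = x ∷ phiGo m (suc pos) k I w

-- φ_I(w): length n+p, letter max(w)+1 at positions of I, letters of w in order elsewhere
φ : List ℕ → Word → Word
φ I w = phiGo (suc (maxW w)) 1 (length w + length I) I w

shiftPos : List ℕ → ℕ → List ℕ
shiftPos I k = map (_+ k) I

-- RedProd u v x  means  x = u ◁_R v  (v = φ_I(v') with v' packed)
RedProd : Word → Word → Word → Set
RedProd u v x =
  Σ (List ℕ) λ I → Σ Word λ v' →
    Packed v' × ValidPos v' I × v ≡ φ I v' ×
    x ≡ φ (shiftPos I (length u)) (u ⊙ v')

IsRedFactorization : Word → Word → Word → Set
IsRedFactorization w u v =
  Packed u × Packed v × v ≢ [] × RedProd u v w ×
  (∀ u' v' → Packed u' → Packed v' → v' ≢ [] → RedProd u' v' w → length u' ≤ length u)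

RedIrreducible : Word → Set
RedIrreducible v =
  Irreducible v ×
  (∀ x y → Packed x → Packed y → y ≢ [] → RedProd x y v → x ≡ [])

{-# OPTIONS --safe #-}
-- Writing v = φ_I(a), both v and w = u ◁_R v insert a new top letter along a boolean mask, v into a
-- and w into u ⊙ a, the mask of w being that of v preceded by |u| falses.  Such an insertion is
-- injective, which yields two cancellation laws: u ◁_R (x ◁_R y) = (u ⊙ x) ◁_R y, and if
-- u ◁_R v = u' ◁_R v' with |u| ≤ |u'| then u' = u ⊙ x and v = x ◁_R v'.  By the first, a left factor
-- x of v gives the left factor u ⊙ x of w, so a maximal u forces x = ε; by the second, a longer left
-- factor u' of w gives a nonempty left factor x of v, packed because u' is.  Irreducibility of v comes
-- from w = u^[max a] · v⁺, where v⁺ is v with its top letter raised to max w: every letter of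
-- u^[max a] exceeds every non-top letter of v, so a global descent c of v gives the descent |u| + c of w.
module Submission where

open import Defs
open import Data.Nat using (ℕ; zero; suc; _+_; _∸_; _≤_; _<_; _⊔_; z≤n; s≤s; _≤?_)
open import Data.Nat.Properties
open import Data.Bool using (Bool; true; false)
open import Data.List using (List; []; _∷_; _++_; map; length; take; drop; replicate)
open import Data.List.Properties
  using (∷-injective; ∷-injectiveˡ; ∷-injectiveʳ; length-map; length-++; length-replicate; map-++;
         map-injective; take-map; drop-map; take++drop≡id; ++-cancelˡ; ++-assoc)
open import Data.List.Membership.Propositional using (_∈_)
open import Data.List.Membership.Propositional.Properties using (∈-map⁺; ∈-map⁻; ∈-++⁺ˡ; ∈-++⁺ʳ; ∈-++⁻)
open import Data.List.Membership.DecPropositional _≟_ using (_∈?_)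
open import Data.List.Relation.Unary.All as All using (All; []; _∷_)
open import Data.List.Relation.Unary.All.Properties using (++⁺; ++⁻ʳ; map⁺)
open import Data.List.Relation.Unary.AllPairs using (AllPairs; []; _∷_)
open import Data.List.Relation.Unary.Any using (here; there)
open import Data.List.Relation.Unary.Linked.Properties using (Linked⇒AllPairs)
open import Data.Product using (_×_; _,_; proj₁; proj₂; ∃; ∃₂)
open import Data.Sum using (inj₁; inj₂)
open import Data.Empty using (⊥-elim)
open import Function using (_∘_)
open import Relation.Nullary using (¬_; yes; no)
open import Relation.Binary.PropositionalEquality hiding (J)

private
  variable
    A B : Set

++-split : ∀ (xs : List A) {xs′ ys ys′} → length xs ≤ length xs′ → xs ++ ys ≡ xs′ ++ ys′ →
  ∃ λ zs → xs′ ≡ xs ++ zs × ys ≡ zs ++ ys′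
++-split [] _ eq = _ , refl , eq
++-split (x ∷ xs) {_ ∷ xs′} (s≤s le) eq with ∷-injective eq
... | refl , eq′ with ++-split xs {xs′} le eq′
... | zs , refl , refl = zs , refl , refl

map-≡-++ : ∀ {f : A → B} xs {ys zs} → map f xs ≡ ys ++ zs →
  ∃₂ λ ys′ zs′ → xs ≡ ys′ ++ zs′ × map f ys′ ≡ ys × map f zs′ ≡ zs
map-≡-++ xs {[]} eq = [] , xs , refl , refl , eq
map-≡-++ (x ∷ xs) {_ ∷ ys} eq with ∷-injective eq
... | refl , eq′ with map-≡-++ xs {ys} eq′
... | ys′ , zs′ , refl , refl , refl = x ∷ ys′ , zs′ , refl , refl , refl

take-++-length : ∀ (xs : List A) {ys} c → take (length xs + c) (xs ++ ys) ≡ xs ++ take c ys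
take-++-length []       c = refl
take-++-length (x ∷ xs) c = cong (x ∷_) (take-++-length xs c)

drop-++-length : ∀ (xs : List A) {ys} c → drop (length xs + c) (xs ++ ys) ≡ drop c ys
drop-++-length []       c = refl
drop-++-length (x ∷ xs) c = drop-++-length xs c

∈-take : ∀ {x : A} c xs → x ∈ take c xs → x ∈ xs
∈-take c xs x∈ = subst (_ ∈_) (take++drop≡id c xs) (∈-++⁺ˡ x∈)

∈-drop : ∀ {x : A} c xs → x ∈ drop c xs → x ∈ xs
∈-drop c xs x∈ = subst (_ ∈_) (take++drop≡id c xs) (∈-++⁺ʳ (take c xs) x∈)

-- Maxima, shifts and ⊙

maxW-++ : ∀ xs ys → maxW (xs ++ ys) ≡ maxW xs ⊔ maxW ys
maxW-++ []       ys = refl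
maxW-++ (x ∷ xs) ys = trans (cong (x ⊔_) (maxW-++ xs ys)) (sym (⊔-assoc x (maxW xs) (maxW ys)))

-- The "⊔ k" absorbs the case u = [], where maxW (shiftW k u) is 0 rather than k.
maxW-shiftW : ∀ k u → maxW (shiftW k u) ⊔ k ≡ k + maxW u
maxW-shiftW k []      = sym (+-identityʳ k)
maxW-shiftW k (x ∷ u) = begin
  ((k + x) ⊔ maxW (shiftW k u)) ⊔ k ≡⟨ ⊔-assoc (k + x) _ k ⟩
  (k + x) ⊔ (maxW (shiftW k u) ⊔ k) ≡⟨ cong ((k + x) ⊔_) (maxW-shiftW k u) ⟩
  (k + x) ⊔ (k + maxW u)            ≡⟨ sym (+-distribˡ-⊔ k x (maxW u)) ⟩
  k + (x ⊔ maxW u)                  ∎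
  where open ≡-Reasoning

maxW-⊙ : ∀ u x → maxW (u ⊙ x) ≡ maxW x + maxW u
maxW-⊙ u x = trans (maxW-++ (shiftW (maxW x) u) x) (maxW-shiftW (maxW x) u)

∈⇒≤maxW : ∀ {y} xs → y ∈ xs → y ≤ maxW xs
∈⇒≤maxW (x ∷ xs) (here refl) = m≤m⊔n x (maxW xs)
∈⇒≤maxW (x ∷ xs) (there y∈)  = ≤-trans (∈⇒≤maxW xs y∈) (m≤n⊔m x (maxW xs))

all<suc-maxW : ∀ xs → All (_< suc (maxW xs)) xs
all<suc-maxW xs = All.tabulate (λ y∈ → s≤s (∈⇒≤maxW xs y∈))

length-shiftW : ∀ k u → length (shiftW k u) ≡ length u
length-shiftW k = length-map (k +_)

shiftW-shiftW : ∀ k l u → shiftW k (shiftW l u) ≡ shiftW (k + l) u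
shiftW-shiftW k l []      = refl
shiftW-shiftW k l (x ∷ u) = cong₂ _∷_ (sym (+-assoc k l x)) (shiftW-shiftW k l u)

length-⊙ : ∀ u x → length (u ⊙ x) ≡ length u + length x
length-⊙ u x = trans (length-++ (shiftW (maxW x) u)) (cong (_+ length x) (length-shiftW (maxW x) u))

length-⊙-≤⇒≡[] : ∀ u x → length (u ⊙ x) ≤ length u → x ≡ []
length-⊙-≤⇒≡[] u []      _  = refl
length-⊙-≤⇒≡[] u (y ∷ x) le =
  ⊥-elim (m+1+n≰m (length u) (subst (_≤ length u) (length-⊙ u (y ∷ x)) le))

⊙-assoc : ∀ u x y → (u ⊙ x) ⊙ y ≡ u ⊙ (x ⊙ y)
⊙-assoc u x y = begin
  shiftW my (shiftW mx u ++ x) ++ y             ≡⟨ cong (_++ y) (map-++ (my +_) (shiftW mx u) x) ⟩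
  (shiftW my (shiftW mx u) ++ shiftW my x) ++ y ≡⟨ ++-assoc (shiftW my (shiftW mx u)) _ y ⟩
  shiftW my (shiftW mx u) ++ (shiftW my x ++ y) ≡⟨ cong (_++ (shiftW my x ++ y)) (shiftW-shiftW my mx u) ⟩
  shiftW (my + mx) u ++ (x ⊙ y)                 ≡⟨ cong (λ k → shiftW k u ++ (x ⊙ y)) (sym (maxW-⊙ x y)) ⟩
  shiftW (maxW (x ⊙ y)) u ++ (x ⊙ y)            ∎
  where
    open ≡-Reasoning
    mx = maxW x
    my = maxW y

⊙-cancel : ∀ u {u′ a a′} → length u ≤ length u′ → u ⊙ a ≡ u′ ⊙ a′ →
  ∃ λ x → u′ ≡ u ⊙ x × a ≡ x ⊙ a′
⊙-cancel u {u′} {a} {a′} u≤u′ eq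
  with ++-split (shiftW (maxW a) u)
         (subst₂ _≤_ (sym (length-shiftW _ u)) (sym (length-shiftW _ u′)) u≤u′) eq
... | zs , u′-split , a≡ with map-≡-++ u′ {shiftW (maxW a) u} {zs} u′-split
... | p , x , u′≡ , p-shift , refl = x , trans u′≡ (cong (_++ x) p≡) , a≡
  where
    p≡ : p ≡ shiftW (maxW x) u
    p≡ = map-injective (+-cancelˡ-≡ (maxW a′) _ _) (begin
      shiftW (maxW a′) p                  ≡⟨ p-shift ⟩
      shiftW (maxW a) u                   ≡⟨ cong (λ k → shiftW k u) (trans (cong maxW a≡) (maxW-⊙ x a′)) ⟩
      shiftW (maxW a′ + maxW x) u         ≡⟨ sym (shiftW-shiftW (maxW a′) (maxW x) u) ⟩
      shiftW (maxW a′) (shiftW (maxW x) u) ∎)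
      where open ≡-Reasoning

packed-⊙ : ∀ {u x} → Packed u → Packed x → Packed (u ⊙ x)
packed-⊙ {u} {x} (u≥1 , u-covers) (x≥1 , x-covers) =
  ++⁺ (map⁺ (All.map (λ {t} 1≤t → ≤-trans 1≤t (m≤n+m t (maxW x))) u≥1)) x≥1 , covers
  where
    covers : ∀ k → 1 ≤ k → k ≤ maxW (u ⊙ x) → k ∈ u ⊙ x
    covers k 1≤k k≤ with k ≤? maxW x
    ... | yes k≤mx = ∈-++⁺ʳ (shiftW (maxW x) u) (x-covers k 1≤k k≤mx)
    ... | no k≰mx  = subst (_∈ u ⊙ x) k≡ (∈-++⁺ˡ (∈-map⁺ (maxW x +_) (u-covers (k ∸ maxW x) 1≤t t≤)))
      where
        mx<k = ≰⇒> k≰mx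
        k≡ : maxW x + (k ∸ maxW x) ≡ k
        k≡ = m+[n∸m]≡n (<⇒≤ mx<k)
        1≤t : 1 ≤ k ∸ maxW x
        1≤t = m<n⇒0<n∸m mx<k
        t≤ : k ∸ maxW x ≤ maxW u
        t≤ = +-cancelˡ-≤ (maxW x) _ _ (subst₂ _≤_ (sym k≡) (maxW-⊙ u x) k≤)

⊙-packedʳ : ∀ {u x} → All (1 ≤_) u → Packed (u ⊙ x) → Packed x
⊙-packedʳ {u} {x} u≥1 (ux≥1 , ux-covers) = ++⁻ʳ (shiftW (maxW x) u) ux≥1 , covers
  where
    covers : ∀ k → 1 ≤ k → k ≤ maxW x → k ∈ x
    covers k 1≤k k≤ with ∈-++⁻ (shiftW (maxW x) u)
                      (ux-covers k 1≤k (≤-trans k≤ (subst (maxW x ≤_) (sym (maxW-⊙ u x)) (m≤m+n _ _))))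
    ... | inj₂ k∈x = k∈x
    ... | inj₁ k∈U with ∈-map⁻ (maxW x +_) k∈U
    ... | t , t∈u , refl with All.lookup u≥1 t∈u
    ... | s≤s _ = ⊥-elim (m+1+n≰m (maxW x) k≤)

-- Global descents

GlobalDescent-map : ∀ {f : ℕ → ℕ} {v c} → (∀ {p y} → p ∈ v → y ∈ v → y < p → f y < f p) →
  GlobalDescent v c → GlobalDescent (map f v) c
GlobalDescent-map {f} {v} {c} f-mono (1≤c , c<v , desc) =
  1≤c , subst (suc c ≤_) (sym (length-map f v)) c<v , desc′
  where
    desc′ : ∀ z → z ∈ take c (map f v) → ∀ y → y ∈ drop c (map f v) → y < z
    desc′ z z∈ y y∈
      with ∈-map⁻ f (subst (z ∈_) (take-map c v) z∈) | ∈-map⁻ f (subst (y ∈_) (drop-map c v) y∈)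
    ... | p , p∈ , refl | q , q∈ , refl = f-mono (∈-take c v p∈) (∈-drop c v q∈) (desc p p∈ q q∈)

GlobalDescent-++ : ∀ U {x c} → GlobalDescent x c → (∀ z → z ∈ U → ∀ y → y ∈ drop c x → y < z) →
  GlobalDescent (U ++ x) (length U + c)
GlobalDescent-++ U {x} {c} (1≤c , c<x , desc) U-above =
  ≤-trans 1≤c (m≤n+m c (length U)) ,
  subst₂ _≤_ (+-suc (length U) c) (sym (length-++ U)) (+-monoʳ-≤ (length U) c<x) ,
  desc′
  where
    desc′ : ∀ z → z ∈ take (length U + c) (U ++ x) → ∀ y → y ∈ drop (length U + c) (U ++ x) → y < z
    desc′ z z∈ y y∈ with ∈-++⁻ U (subst (z ∈_) (take-++-length U c) z∈)
    ... | inj₁ z∈U = U-above z z∈U y (subst (y ∈_) (drop-++-length U c) y∈)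
    ... | inj₂ z∈x = desc z z∈x y (subst (y ∈_) (drop-++-length U c) y∈)

GlobalDescent-drop-< : ∀ {v c y} → GlobalDescent v c → y ∈ drop c v → y < maxW v
GlobalDescent-drop-< {[]}    (_ , () , _)
GlobalDescent-drop-< {_ ∷ _} {zero} (() , _)
GlobalDescent-drop-< {p ∷ v} {suc c} (_ , _ , desc) y∈ = <-≤-trans (desc p (here refl) _ y∈) (m≤m⊔n p (maxW v))

replace : ℕ → ℕ → ℕ → ℕ
replace m M y with y ≟ m
... | yes _ = M
... | no  _ = y

replace-self : ∀ m M → replace m M m ≡ M
replace-self m M with m ≟ m
... | yes _  = refl
... | no m≢m = ⊥-elim (m≢m refl)

replace-< : ∀ {m M y} → y < m → replace m M y ≡ y
replace-< {m} {M} {y} y<m with y ≟ m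
... | yes refl = ⊥-elim (<-irrefl refl y<m)
... | no  _    = refl

replace-mono : ∀ {m M y p} → m ≤ M → y < p → p ≤ m → replace m M y < replace m M p
replace-mono {m} {M} {y} {p} m≤M y<p p≤m with m≤n⇒m<n∨m≡n p≤m
... | inj₁ p<m = subst₂ _<_ (sym (replace-< (<-trans y<p p<m))) (sym (replace-< p<m)) y<p
... | inj₂ refl = subst₂ _<_ (sym (replace-< y<p)) (sym (replace-self p M)) (<-≤-trans y<p m≤M)

-- Inserting a letter along a boolean mask

mask : ℕ → ℕ → List ℕ → List Bool
mask p zero    J = []
mask p (suc k) J with p ∈? J
... | yes _ = true  ∷ mask (suc p) k J
... | no  _ = false ∷ mask (suc p) k J

merge : List Bool → ℕ → Word → Word
merge []           m A       = []
merge (true  ∷ bs) m A       = m ∷ merge bs m A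
merge (false ∷ bs) m []      = []
merge (false ∷ bs) m (x ∷ A) = x ∷ merge bs m A

trues : List Bool → ℕ
trues []           = 0
trues (true  ∷ bs) = suc (trues bs)
trues (false ∷ bs) = trues bs

falses : ℕ → List Bool
falses n = replicate n false

Fits : List Bool → Word → Set
Fits bs A = length bs ≡ length A + trues bs

phiGo-mask : ∀ m p k J A → phiGo m p k J A ≡ merge (mask p k J) m A
phiGo-mask m p zero    J A = refl
phiGo-mask m p (suc k) J A with p ∈? J
... | yes _ = cong (m ∷_) (phiGo-mask m (suc p) k J A)
phiGo-mask m p (suc k) J []      | no _ = refl
phiGo-mask m p (suc k) J (x ∷ A) | no _ = cong (x ∷_) (phiGo-mask m (suc p) k J A)

length-mask : ∀ p k J → length (mask p k J) ≡ k
length-mask p zero    J = refl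
length-mask p (suc k) J with p ∈? J
... | yes _ = cong suc (length-mask (suc p) k J)
... | no  _ = cong suc (length-mask (suc p) k J)

mask-cong : ∀ p k J J′ → (∀ r → p ≤ r → r ∈ J → r ∈ J′) → (∀ r → p ≤ r → r ∈ J′ → r ∈ J) →
  mask p k J ≡ mask p k J′
mask-cong p zero    J J′ J⊆J′ J′⊆J = refl
mask-cong p (suc k) J J′ J⊆J′ J′⊆J with p ∈? J | p ∈? J′
... | yes _   | yes _    = cong (true  ∷_) (mask-cong (suc p) k J J′ (λ r → J⊆J′ r ∘ <⇒≤) (λ r → J′⊆J r ∘ <⇒≤))
... | no  _   | no  _    = cong (false ∷_) (mask-cong (suc p) k J J′ (λ r → J⊆J′ r ∘ <⇒≤) (λ r → J′⊆J r ∘ <⇒≤))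
... | yes p∈J | no p∉J′  = ⊥-elim (p∉J′ (J⊆J′ p ≤-refl p∈J))
... | no p∉J  | yes p∈J′ = ⊥-elim (p∉J (J′⊆J p ≤-refl p∈J′))

mask-+ : ∀ d p k J → mask p (d + k) J ≡ mask p d J ++ mask (p + d) k J
mask-+ zero    p k J = cong (λ q → mask q k J) (sym (+-identityʳ p))
mask-+ (suc d) p k J rewrite +-suc p d with p ∈? J
... | yes _ = cong (true  ∷_) (mask-+ d (suc p) k J)
... | no  _ = cong (false ∷_) (mask-+ d (suc p) k J)

mask-below : ∀ d p J → (∀ j → j ∈ J → p + d ≤ j) → mask p d J ≡ falses d
mask-below zero    p J J-above = refl
mask-below (suc d) p J J-above with p ∈? J
... | yes p∈J = ⊥-elim (m+1+n≰m p (J-above p p∈J))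
... | no  _   = cong (false ∷_) (mask-below d (suc p) J (λ j j∈ → subst (_≤ j) (+-suc p d) (J-above j j∈)))

mask-shiftPos : ∀ p d k J → mask (p + d) k (shiftPos J d) ≡ mask p k J
mask-shiftPos p d zero    J = refl
mask-shiftPos p d (suc k) J with (p + d) ∈? shiftPos J d | p ∈? J
... | yes _   | yes _   = cong (true  ∷_) (mask-shiftPos (suc p) d k J)
... | no  _   | no  _   = cong (false ∷_) (mask-shiftPos (suc p) d k J)
... | no p∉J′ | yes p∈J = ⊥-elim (p∉J′ (∈-map⁺ (_+ d) p∈J))
... | yes p∈J′ | no p∉J with ∈-map⁻ (_+ d) p∈J′
... | j , j∈J , p+d≡ = ⊥-elim (p∉J (subst (_∈ J) (sym (+-cancelʳ-≡ d p j p+d≡)) j∈J))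

trues-mask : ∀ k p J → AllPairs _<_ J → (∀ j → j ∈ J → p ≤ j × j < p + k) →
  trues (mask p k J) ≡ length J
trues-mask zero p []      _ _ = refl
trues-mask zero p (j ∷ J) _ range =
  ⊥-elim (<⇒≱ (subst (j <_) (+-identityʳ p) (proj₂ (range j (here refl)))) (proj₁ (range j (here refl))))
trues-mask (suc k) p J sorted range with p ∈? J
trues-mask (suc k) p (j ∷ J) (j<J ∷ sorted) range | yes (here refl) =
  cong suc (trans (cong trues (mask-cong (suc p) k (p ∷ J) J drop-p (λ _ _ → there)))
                  (trues-mask k (suc p) J sorted range′))
  where
    drop-p : ∀ r → suc p ≤ r → r ∈ p ∷ J → r ∈ J
    drop-p r p<r (here refl) = ⊥-elim (<-irrefl refl p<r)
    drop-p r p<r (there r∈J) = r∈J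
    range′ : ∀ i → i ∈ J → suc p ≤ i × i < suc p + k
    range′ i i∈ = All.lookup j<J i∈ , subst (i <_) (+-suc p k) (proj₂ (range i (there i∈)))
trues-mask (suc k) p (j ∷ J) (j<J ∷ _) range | yes (there p∈J) =
  ⊥-elim (<⇒≱ (All.lookup j<J p∈J) (proj₁ (range j (here refl))))
... | no p∉J = trues-mask k (suc p) J sorted range′
  where
    range′ : ∀ i → i ∈ J → suc p ≤ i × i < suc p + k
    range′ i i∈ = ≤∧≢⇒< (proj₁ (range i i∈)) (λ p≡i → p∉J (subst (_∈ J) (sym p≡i) i∈)) ,
                  subst (i <_) (+-suc p k) (proj₂ (range i i∈))

trues≤length : ∀ bs → trues bs ≤ length bs
trues≤length []           = z≤n
trues≤length (true  ∷ bs) = s≤s (trues≤length bs)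
trues≤length (false ∷ bs) = m≤n⇒m≤1+n (trues≤length bs)

¬Fits-false-[] : ∀ bs → ¬ Fits (false ∷ bs) []
¬Fits-false-[] bs fits = <⇒≱ (s≤s ≤-refl) (subst (_≤ length bs) (sym fits) (trues≤length bs))

Fits-true⁻ : ∀ bs A → Fits (true ∷ bs) A → Fits bs A
Fits-true⁻ bs A fits = suc-injective (trans fits (+-suc (length A) (trues bs)))

-- A letter m exceeding every letter of A can be told apart from them, so the mask is recovered too.
merge-injective : ∀ {m} bs bs′ A A′ → All (_< m) A → All (_< m) A′ → Fits bs A → Fits bs′ A′ →
  merge bs m A ≡ merge bs′ m A′ → bs ≡ bs′ × A ≡ A′
merge-injective (false ∷ bs) _ [] _ _ _ fits _ _ = ⊥-elim (¬Fits-false-[] bs fits)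
merge-injective _ (false ∷ bs′) _ [] _ _ _ fits′ _ = ⊥-elim (¬Fits-false-[] bs′ fits′)
merge-injective [] [] [] []      _ _ _ _  _ = refl , refl
merge-injective [] [] [] (_ ∷ _) _ _ _ () _
merge-injective [] [] (_ ∷ _) _  _ _ () _ _
merge-injective [] (true ∷ _) _ _ _ _ _ _ ()
merge-injective [] (false ∷ _) _ (_ ∷ _) _ _ _ _ ()
merge-injective (true ∷ _) [] _ _ _ _ _ _ ()
merge-injective (false ∷ _) [] (_ ∷ _) _ _ _ _ _ ()
merge-injective (true ∷ bs) (true ∷ bs′) A A′ A<m A′<m fits fits′ eq
  with merge-injective bs bs′ A A′ A<m A′<m (Fits-true⁻ bs A fits) (Fits-true⁻ bs′ A′ fits′)
         (∷-injectiveʳ eq)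
... | refl , refl = refl , refl
merge-injective (true ∷ _) (false ∷ _) _ (_ ∷ _) _ (x<m ∷ _) _ _ eq = ⊥-elim (<-irrefl (sym (∷-injectiveˡ eq)) x<m)
merge-injective (false ∷ _) (true ∷ _) (_ ∷ _) _ (x<m ∷ _) _ _ _ eq = ⊥-elim (<-irrefl (∷-injectiveˡ eq) x<m)
merge-injective (false ∷ bs) (false ∷ bs′) (x ∷ A) (_ ∷ A′) (_ ∷ A<m) (_ ∷ A′<m) fits fits′ eq
  with ∷-injective eq
... | refl , eq′ with merge-injective bs bs′ A A′ A<m A′<m (suc-injective fits) (suc-injective fits′) eq′
... | refl , refl = refl , refl

maxW-merge-≤ : ∀ {m} bs A → All (_≤ m) A → maxW (merge bs m A) ≤ m
maxW-merge-≤ []           A       _          = z≤n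
maxW-merge-≤ (true  ∷ bs) A       A≤m        = ⊔-lub ≤-refl (maxW-merge-≤ bs A A≤m)
maxW-merge-≤ (false ∷ bs) []      _          = z≤n
maxW-merge-≤ (false ∷ bs) (x ∷ A) (x≤m ∷ A≤m) = ⊔-lub x≤m (maxW-merge-≤ bs A A≤m)

maxW-merge : ∀ {m} bs A → All (_≤ m) A → Fits bs A → 1 ≤ trues bs → maxW (merge bs m A) ≡ m
maxW-merge (true ∷ bs) A A≤m _ _ = m≥n⇒m⊔n≡m (maxW-merge-≤ bs A A≤m)
maxW-merge (false ∷ bs) [] _ fits _ = ⊥-elim (¬Fits-false-[] bs fits)
maxW-merge (false ∷ bs) (x ∷ A) (x≤m ∷ A≤m) fits 1≤trues =
  trans (cong (x ⊔_) (maxW-merge bs A A≤m (suc-injective fits) 1≤trues)) (m≤n⇒m⊔n≡n x≤m)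

merge-falses : ∀ U bs m A → merge (falses (length U) ++ bs) m (U ++ A) ≡ U ++ merge bs m A
merge-falses []      bs m A = refl
merge-falses (x ∷ U) bs m A = cong (x ∷_) (merge-falses U bs m A)

merge-replace : ∀ {m M} bs A → All (_< m) A → merge bs M A ≡ map (replace m M) (merge bs m A)
merge-replace {m} {M} []           A       _          = refl
merge-replace {m} {M} (true  ∷ bs) A       A<m        = cong₂ _∷_ (sym (replace-self m M)) (merge-replace bs A A<m)
merge-replace         (false ∷ bs) []      _          = refl
merge-replace         (false ∷ bs) (x ∷ A) (x<m ∷ A<m) = cong₂ _∷_ (sym (replace-< x<m)) (merge-replace bs A A<m)

-- φ in terms of masks

φᵇ : List Bool → Word → Word
φᵇ bs A = merge bs (suc (maxW A)) A

record IsMask (bs : List Bool) (A : Word) : Set where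
  constructor isMask
  field
    fits     : Fits bs A
    trues≥1 : 1 ≤ trues bs

maxW-φᵇ : ∀ {bs A} → IsMask bs A → maxW (φᵇ bs A) ≡ suc (maxW A)
maxW-φᵇ {bs} {A} (isMask fits 1≤trues) =
  maxW-merge bs A (All.map <⇒≤ (all<suc-maxW A)) fits 1≤trues

φᵇ-injective : ∀ {bs bs′ A A′} → IsMask bs A → IsMask bs′ A′ → φᵇ bs A ≡ φᵇ bs′ A′ →
  bs ≡ bs′ × A ≡ A′
φᵇ-injective {bs} {bs′} {A} {A′} mask mask′ eq =
  merge-injective bs bs′ A A′
    (all<suc-maxW A) (subst (λ k → All (_< suc k) A′) (sym maxW≡) (all<suc-maxW A′))
    (IsMask.fits mask) (IsMask.fits mask′) (trans eq (cong (λ k → merge bs′ (suc k) A′) (sym maxW≡)))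
  where
    maxW≡ : maxW A ≡ maxW A′
    maxW≡ = suc-injective (trans (sym (maxW-φᵇ mask)) (trans (cong maxW eq) (maxW-φᵇ mask′)))

trues-falses : ∀ n bs → trues (falses n ++ bs) ≡ trues bs
trues-falses zero    bs = refl
trues-falses (suc n) bs = trues-falses n bs

falses-+ : ∀ m n bs → falses (m + n) ++ bs ≡ falses m ++ falses n ++ bs
falses-+ zero    n bs = refl
falses-+ (suc m) n bs = cong (false ∷_) (falses-+ m n bs)

falses-length-⊙ : ∀ u x bs → falses (length (u ⊙ x)) ++ bs ≡ falses (length u) ++ falses (length x) ++ bs
falses-length-⊙ u x bs = trans (cong (λ l → falses l ++ bs) (length-⊙ u x)) (falses-+ (length u) (length x) bs)

IsMask-falses : ∀ u {bs a} → IsMask bs a → IsMask (falses (length u) ++ bs) (u ⊙ a)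
IsMask-falses u {bs} {a} (isMask fits 1≤trues) =
  isMask fits′ (subst (1 ≤_) (sym (trues-falses (length u) bs)) 1≤trues)
  where
    open ≡-Reasoning
    fits′ : Fits (falses (length u) ++ bs) (u ⊙ a)
    fits′ = begin
      length (falses (length u) ++ bs)          ≡⟨ length-++ (falses (length u)) ⟩
      length (falses (length u)) + length bs    ≡⟨ cong₂ _+_ (length-replicate (length u)) fits ⟩
      length u + (length a + trues bs)          ≡⟨ sym (+-assoc (length u) (length a) _) ⟩
      (length u + length a) + trues bs          ≡⟨ cong₂ _+_ (sym (length-⊙ u a)) (sym (trues-falses (length u) bs)) ⟩
      length (u ⊙ a) + trues (falses (length u) ++ bs) ∎

posMask : Word → List ℕ → List Bool
posMask a I = mask 1 (length a + length I) I

φ≡φᵇ : ∀ I a → φ I a ≡ φᵇ (posMask a I) a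
φ≡φᵇ I a = phiGo-mask (suc (maxW a)) 1 (length a + length I) I a

posMask-isMask : ∀ {a I} → ValidPos a I → IsMask (posMask a I) a
posMask-isMask {a} {I} (I≢[] , sorted , I-range) = isMask
  (trans (length-mask 1 k I) (cong (length a +_) (sym trues≡)))
  (subst (1 ≤_) (sym trues≡) (nonempty I I≢[]))
  where
    k = length a + length I
    trues≡ : trues (posMask a I) ≡ length I
    trues≡ = trues-mask k 1 I (Linked⇒AllPairs <-trans sorted)
               (λ i i∈ → proj₁ (All.lookup I-range i∈) , s≤s (proj₂ (All.lookup I-range i∈)))
    nonempty : ∀ (J : List ℕ) → J ≢ [] → 1 ≤ length J
    nonempty []      J≢[] = ⊥-elim (J≢[] refl)
    nonempty (_ ∷ _) _    = s≤s z≤n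

-- Positions I + |u| start after the |u| letters of u^[max a], which φ therefore leaves in place.
φ-shiftPos : ∀ u {a I} → ValidPos a I →
  φ (shiftPos I (length u)) (u ⊙ a) ≡ φᵇ (falses (length u) ++ posMask a I) (u ⊙ a)
φ-shiftPos u {a} {I} (_ , _ , I-range) = begin
  phiGo M 1 l J (u ⊙ a)                    ≡⟨ phiGo-mask M 1 l J (u ⊙ a) ⟩
  merge (mask 1 l J) M (u ⊙ a)             ≡⟨ cong (λ len → merge (mask 1 len J) M (u ⊙ a)) l≡ ⟩
  merge (mask 1 (n + k) J) M (u ⊙ a)       ≡⟨ cong (λ bs → merge bs M (u ⊙ a)) mask≡ ⟩
  merge (falses n ++ mask 1 k I) M (u ⊙ a) ∎
  where
    open ≡-Reasoning
    n = length u
    k = length a + length I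
    J = shiftPos I n
    M = suc (maxW (u ⊙ a))
    l = length (u ⊙ a) + length J
    l≡ : l ≡ n + k
    l≡ = trans (cong₂ _+_ (length-⊙ u a) (length-map (_+ n) I)) (+-assoc n (length a) (length I))
    J-above : ∀ j → j ∈ J → 1 + n ≤ j
    J-above j j∈ with ∈-map⁻ (_+ n) j∈
    ... | i , i∈ , refl = +-monoˡ-≤ n (proj₁ (All.lookup I-range i∈))
    mask≡ : mask 1 (n + k) J ≡ falses n ++ mask 1 k I
    mask≡ = trans (mask-+ n 1 k J) (cong₂ _++_ (mask-below n 1 J J-above) (mask-shiftPos 1 n k I))

φ-shiftPos-++ : ∀ u {a I} → ValidPos a I →
  φ (shiftPos I (length u)) (u ⊙ a) ≡
  shiftW (maxW a) u ++ map (replace (suc (maxW a)) (suc (maxW (u ⊙ a)))) (φ I a)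
φ-shiftPos-++ u {a} {I} vp = begin
  φ (shiftPos I (length u)) (u ⊙ a)              ≡⟨ φ-shiftPos u vp ⟩
  merge (falses (length u) ++ bs) M (U ++ a)     ≡⟨ cong (λ l → merge (falses l ++ bs) M (U ++ a)) U-length ⟩
  merge (falses (length U) ++ bs) M (U ++ a)     ≡⟨ merge-falses U bs M a ⟩
  U ++ merge bs M a                              ≡⟨ cong (U ++_) (merge-replace bs a (all<suc-maxW a)) ⟩
  U ++ map (replace m M) (φᵇ bs a)               ≡⟨ cong (λ z → U ++ map (replace m M) z) (sym (φ≡φᵇ I a)) ⟩
  U ++ map (replace m M) (φ I a)                 ∎
  where
    open ≡-Reasoning
    bs = posMask a I
    U = shiftW (maxW a) u
    m = suc (maxW a)
    M = suc (maxW (u ⊙ a))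
    U-length : length u ≡ length U
    U-length = sym (length-shiftW (maxW a) u)

-- Red products

redProd-⊙ : ∀ {x y v u w} → RedProd x y v → RedProd u v w → RedProd (u ⊙ x) y w
redProd-⊙ {x} {y} {v} {u} {w} (J , b , pb , vpJ , y≡ , v≡) (I , a , _ , vpI , v≡′ , w≡) =
  J , b , pb , vpJ , y≡ , w≡′
  where
    open ≡-Reasoning
    masks≡ : posMask a I ≡ falses (length x) ++ posMask b J × a ≡ x ⊙ b
    masks≡ = φᵇ-injective (posMask-isMask vpI) (IsMask-falses x (posMask-isMask vpJ)) (begin
      φᵇ (posMask a I) a                            ≡⟨ sym (φ≡φᵇ I a) ⟩
      φ I a                                         ≡⟨ sym v≡′ ⟩
      v                                             ≡⟨ v≡ ⟩
      φ (shiftPos J (length x)) (x ⊙ b)             ≡⟨ φ-shiftPos x vpJ ⟩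
      φᵇ (falses (length x) ++ posMask b J) (x ⊙ b) ∎)
    w≡′ : w ≡ φ (shiftPos J (length (u ⊙ x))) ((u ⊙ x) ⊙ b)
    w≡′ = begin
      w
        ≡⟨ w≡ ⟩
      φ (shiftPos I (length u)) (u ⊙ a)
        ≡⟨ φ-shiftPos u vpI ⟩
      φᵇ (falses (length u) ++ posMask a I) (u ⊙ a)
        ≡⟨ cong₂ (λ bs c → φᵇ (falses (length u) ++ bs) (u ⊙ c)) (proj₁ masks≡) (proj₂ masks≡) ⟩
      φᵇ (falses (length u) ++ falses (length x) ++ posMask b J) (u ⊙ (x ⊙ b))
        ≡⟨ cong₂ φᵇ (sym (falses-length-⊙ u x _)) (sym (⊙-assoc u x b)) ⟩
      φᵇ (falses (length (u ⊙ x)) ++ posMask b J) ((u ⊙ x) ⊙ b)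
        ≡⟨ sym (φ-shiftPos (u ⊙ x) vpJ) ⟩
      φ (shiftPos J (length (u ⊙ x))) ((u ⊙ x) ⊙ b)
        ∎

redProd-cancel : ∀ {u v w u′ v′} → RedProd u v w → RedProd u′ v′ w → length u ≤ length u′ →
  ∃ λ x → u′ ≡ u ⊙ x × RedProd x v′ v
redProd-cancel {u} {v} {w} {u′}
  (I , a , _ , vpI , v≡ , w≡) (I′ , a′ , pa′ , vpI′ , v′≡ , w≡′) u≤u′
  with φᵇ-injective (IsMask-falses u (posMask-isMask vpI)) (IsMask-falses u′ (posMask-isMask vpI′))
         (trans (sym (φ-shiftPos u vpI)) (trans (sym w≡) (trans w≡′ (φ-shiftPos u′ vpI′))))
... | masks≡ , ⊙≡ with ⊙-cancel u {u′} {a} {a′} u≤u′ ⊙≡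
... | x , refl , a≡ = x , refl , I′ , a′ , pa′ , vpI′ , v′≡ , v≡′
  where
    open ≡-Reasoning
    posMask≡ : posMask a I ≡ falses (length x) ++ posMask a′ I′
    posMask≡ = ++-cancelˡ (falses (length u)) _ _ (trans masks≡ (falses-length-⊙ u x _))
    v≡′ : v ≡ φ (shiftPos I′ (length x)) (x ⊙ a′)
    v≡′ = begin
      v                                                ≡⟨ v≡ ⟩
      φ I a                                            ≡⟨ φ≡φᵇ I a ⟩
      φᵇ (posMask a I) a                               ≡⟨ cong₂ φᵇ posMask≡ a≡ ⟩
      φᵇ (falses (length x) ++ posMask a′ I′) (x ⊙ a′) ≡⟨ sym (φ-shiftPos x vpI′) ⟩
      φ (shiftPos I′ (length x)) (x ⊙ a′)              ∎

irreducible-right : ∀ {u v w} → All (1 ≤_) u → RedProd u v w → Irreducible w → v ≢ [] → Irreducible v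
irreducible-right {u} {v} {w} u≥1 (I , a , _ , vp , v≡ , w≡) (_ , no-descent-w) v≢[] =
  v≢[] , no-descent-v
  where
    m = suc (maxW a)
    M = suc (maxW (u ⊙ a))
    U = shiftW (maxW a) u
    w≡U++ : w ≡ U ++ map (replace m M) v
    w≡U++ = trans w≡ (trans (φ-shiftPos-++ u vp) (cong (λ z → U ++ map (replace m M) z) (sym v≡)))
    maxW-v : maxW v ≡ m
    maxW-v = trans (cong maxW (trans v≡ (φ≡φᵇ I a))) (maxW-φᵇ (posMask-isMask {a} {I} vp))
    m≤M : m ≤ M
    m≤M = s≤s (subst (maxW a ≤_) (sym (maxW-⊙ u a)) (m≤m+n (maxW a) (maxW u)))
    replace-mono-v : ∀ {p y} → p ∈ v → y ∈ v → y < p → replace m M y < replace m M p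
    replace-mono-v p∈ _ y<p = replace-mono m≤M y<p (subst (_ ≤_) maxW-v (∈⇒≤maxW v p∈))
    no-descent-v : ∀ c → ¬ GlobalDescent v c
    no-descent-v c descent = no-descent-w (length U + c)
      (subst (λ z → GlobalDescent z (length U + c)) (sym w≡U++)
        (GlobalDescent-++ U (GlobalDescent-map replace-mono-v descent) U-above))
      where
        U-above : ∀ z → z ∈ U → ∀ y → y ∈ drop c (map (replace m M) v) → y < z
        U-above z z∈ y′ y′∈
          with ∈-map⁻ (maxW a +_) z∈ | ∈-map⁻ (replace m M) (subst (y′ ∈_) (drop-map c v) y′∈)
        ... | t , t∈u , refl | y , y∈ , refl =
          subst (_< maxW a + t) (sym (replace-< y<m))
            (<-≤-trans (subst (y <_) (+-comm 1 (maxW a)) y<m) (+-monoʳ-≤ (maxW a) (All.lookup u≥1 t∈u)))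
          where
            y<m : y < m
            y<m = subst (y <_) maxW-v (GlobalDescent-drop-< descent y∈)

mainTheorem9 : ∀ (w u v : Word) → Packed w → Irreducible w →
    Packed u → Packed v → v ≢ [] → RedProd u v w →
    (IsRedFactorization w u v → RedIrreducible v) × (RedIrreducible v → IsRedFactorization w u v)
mainTheorem9 w u v _ w-irreducible pu pv v≢[] uv=w = maximal⇒redIrreducible , redIrreducible⇒maximal
  where
    maximal⇒redIrreducible : IsRedFactorization w u v → RedIrreducible v
    maximal⇒redIrreducible (_ , _ , _ , _ , maximal) =
      irreducible-right (proj₁ pu) uv=w w-irreducible v≢[] ,
      λ x y px py y≢[] xy=v →
        length-⊙-≤⇒≡[] u x (maximal (u ⊙ x) y (packed-⊙ pu px) py y≢[] (redProd-⊙ {u = u} xy=v uv=w))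

    redIrreducible⇒maximal : RedIrreducible v → IsRedFactorization w u v
    redIrreducible⇒maximal (_ , no-left-factor) = pu , pv , v≢[] , uv=w , maximal
      where
        maximal : ∀ u′ v′ → Packed u′ → Packed v′ → v′ ≢ [] → RedProd u′ v′ w → length u′ ≤ length u
        maximal u′ v′ pu′ pv′ v′≢[] u′v′=w with ≤-total (length u′) (length u)
        ... | inj₁ u′≤u = u′≤u
        ... | inj₂ u≤u′ with redProd-cancel {u} {u′ = u′} uv=w u′v′=w u≤u′
        ... | x , refl , xv′=v with no-left-factor x v′ (⊙-packedʳ (proj₁ pu) pu′) pv′ v′≢[] xv′=v
        ... | refl = ≤-reflexive (trans (length-⊙ u []) (+-identityʳ (length u)))
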